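{- Let $(g,f_1,f_2)$ be a Sprugnoli array with matrix $M$, let $\overline{M}$ be $M$ with its top row removed, and let $P=M^{ -1}\overline{M}$ be its production matrix. Let $A(x)=\sum_{n\ge0}P_{n,1}x^n$ be the generating function of column $1$ of $P$ and let $B(x)$ be defined by $xB(x)=\sum_{n\ge0}P_{n,2}x^n$ (the generating function of column $2$ of $P$), columns being indexed from $0$. Let $(1,r_1,r_2)=(1,f_1,f_2)^{ -1}$ be the inverse of $(1,f_1,f_2)$ in the Sprugnoli group. Then $$A(x)=(1,r_1,r_2)\cdot\frac{f_1(x)}{x},\qquad B(x)=\frac{1}{x}\,(1,r_1,r_2)\cdot f_2(x).$$
   Context: All power series are formal power series over a field $\mathbb{K}$ of characteristic $0$. $\mathcal{F}_r$ denotes the set of power series $\sum_{n\ge r}a_nx^n$ with $a_r\ne0$. A Sprugnoli array is a triple $(g,f_1,f_2)$ with $g\in\mathcal{F}_0$, $f_1\in\mathcal{F}_1$, $f_2\in\mathcal{F}_1$ and $f_2$ odd (only odd powers of $x$); its matrix is the lower-triangular matrix $(t_{n,k})_{n,k\ge0}$ with $t_{n,k}=[x^n]\,g(x)f_1(x)^{k\bmod 2}(xf_2(x))^{\lfloor k/2\rfloor}$ (invertible, having nonzero diagonal). For $h=\sum_n a_nx^n$, $(g,f_1,f_2)\cdot h=\sum_n(\sum_k t_{n,k}a_k)x^n$. The Sprugnoli arrays form a group (the Sprugnoli group) under the product $S\cdot(u,v_1,v_2)=\left(S\cdot u,\frac{S\cdot(uv_1)}{S\cdot u},\frac1x\frac{S\cdot(xuv_2)}{S\cdot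 u}\right)$ for $S=(g,f_1,f_2)$, with identity $(1,x,x)$; this product corresponds to multiplication of the associated matrices, so the matrix of the inverse array is the inverse matrix. -}

module Defs where

open import Level using (Level; _⊔_) renaming (suc to lsuc)
open import Algebra.Bundles using (CommutativeRing)
open import Data.Nat as ℕ using (ℕ; zero; suc; _<_; _∸_)
open import Data.Nat.DivMod using (_%_; _/_)
open import Data.Product using (_×_; ∃)
open import Relation.Nullary using (¬_)

record Field (c ℓ : Level) : Set (lsuc (c ⊔ ℓ)) where
  field
    commutativeRing : CommutativeRing c ℓ
  open CommutativeRing commutativeRing public
  field
    1≉0 : ¬ (1# ≈ 0#)
    inverse : ∀ x → ¬ (x ≈ 0#) → ∃ λ y → x * y ≈ 1#

module Sprugnoli {c ℓ : Level} (K : Field c ℓ) where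
  open Field K

  natK : ℕ → Carrier
  natK zero = 0#
  natK (suc n) = 1# + natK n

  CharZero : Set ℓ
  CharZero = ∀ n → ¬ (natK (suc n) ≈ 0#)

  Series : Set c
  Series = ℕ → Carrier

  infix 4 _≋_
  _≋_ : Series → Series → Set ℓ
  f ≋ h = ∀ n → f n ≈ h n

  Σ≤ : ℕ → (ℕ → Carrier) → Carrier
  Σ≤ zero h = h 0
  Σ≤ (suc n) h = Σ≤ n h + h (suc n)

  infixl 7 _*ₛ_
  _*ₛ_ : Series → Series → Series
  (f *ₛ h) n = Σ≤ n (λ k → f k * h (n ∸ k))

  oneₛ : Series
  oneₛ zero = 1#
  oneₛ (suc n) = 0#

  X : Series
  X zero = 0#
  X (suc zero) = 1#
  X (suc (suc n)) = 0#

  powₛ : Series → ℕ → Series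
  powₛ f zero = oneₛ
  powₛ f (suc k) = f *ₛ powₛ f k

  -- division by x of a series with zero constant term:  (h/x)_n = h_{n+1}
  divX : Series → Series
  divX h n = h (suc n)

  InF : ℕ → Series → Set ℓ
  InF r f = (∀ n → n < r → f n ≈ 0#) × ¬ (f r ≈ 0#)

  Odd : Series → Set ℓ
  Odd f = ∀ n → f (2 ℕ.* n) ≈ 0#

  IsSprugnoli : Series → Series → Series → Set ℓ
  IsSprugnoli g f₁ f₂ = InF 0 g × InF 1 f₁ × InF 1 f₂ × Odd f₂

  Matrix : Set c
  Matrix = ℕ → ℕ → Carrier

  matrixOf : Series → Series → Series → Matrix
  matrixOf g f₁ f₂ n k = (g *ₛ powₛ f₁ (k % 2) *ₛ powₛ (X *ₛ f₂) (k / 2)) n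

  -- action on a series: (S·h)_n = Σ_k t_{n,k} a_k  (t_{n,k} = 0 for k > n)
  act : Series → Series → Series → Series → Series
  act g f₁ f₂ h n = Σ≤ n (λ k → matrixOf g f₁ f₂ n k * h k)

  LowerTriangular : Matrix → Set ℓ
  LowerTriangular A = ∀ n k → n < k → A n k ≈ 0#

  -- product of lower-triangular matrices (finite sums)
  _∙ₘ_ : Matrix → Matrix → Matrix
  (A ∙ₘ B) n k = Σ≤ n (λ j → A n j * B j k)

  idₘ : Matrix
  idₘ n k with n ℕ.≟ k
  ... | Relation.Nullary.yes _ = 1#
  ... | Relation.Nullary.no _ = 0#

  _≋ₘ_ : Matrix → Matrix → Set ℓ
  A ≋ₘ B = ∀ n k → A n k ≈ B n k

  IsInverseOf : Matrix → Matrix → Set ℓ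
  IsInverseOf Minv M = LowerTriangular Minv × (Minv ∙ₘ M) ≋ₘ idₘ × (M ∙ₘ Minv) ≋ₘ idₘ

  dropTop : Matrix → Matrix
  dropTop M n k = M (suc n) k

  -- production matrix P = Minv · M̄  (Minv lower triangular, so the sum is finite)
  production : Matrix → Matrix → Matrix
  production Minv M = Minv ∙ₘ dropTop M

  column : Matrix → ℕ → Series
  column A k n = A n k

  -- The group product  (g,f₁,f₂)·(u,v₁,v₂) = (w,w₁,w₂)  with
  --   w = S·u,  w₁ = S·(u v₁)/(S·u),  w₂ = (1/x) S·(x u v₂)/(S·u),
  -- written without division (S·u is invertible, so this determines w₁, w₂).
  ProductIs : (g f₁ f₂ u v₁ v₂ w w₁ w₂ : Series) → Set ℓ
  ProductIs g f₁ f₂ u v₁ v₂ w w₁ w₂ =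
    (w ≋ act g f₁ f₂ u)
    × (w *ₛ w₁ ≋ act g f₁ f₂ (u *ₛ v₁))
    × (X *ₛ (w *ₛ w₂) ≋ act g f₁ f₂ (X *ₛ u *ₛ v₂))

-- Let T be the matrix of (1, f₁, f₂) and R that of (1, r₁, r₂).  Column k + 2 of T is x f₂
-- times column k, so T acts multiplicatively on products e h whenever e is an even series;
-- e = x r₂ is one.  The three equations defining the group product say T·1 = 1, T·r₁ = x
-- and T·(x r₂) = x², hence T sends column l of R to x^l, i.e. T R = I.  Column K of the
-- matrix M of (g, f₁, f₂) is g times column K of T, so if column K of M̄ is g u then it
-- equals M (R u), and column K of P = M⁻¹ M̄ is R u.  Columns 1 and 2 of M̄ are g f₁/x and
-- g f₂.

module Submission where

open import Defs
open import Level using (Level)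
open import Data.Product using (_×_; _,_; ∃-syntax)
open import Data.Sum using (_⊎_; inj₁; inj₂)
open import Data.Nat as ℕ using (ℕ; zero; suc; _≤_; _<_; _∸_; z≤n; s≤s)
import Data.Nat.Properties as ℕₚ
open import Data.Nat.DivMod using (m/n≡1+[m∸n]/n)
open import Relation.Binary.PropositionalEquality as ≡ using (_≡_; _≢_)
open import Relation.Nullary using (yes; no)
open import Data.Empty using (⊥-elim)
open import Function using (_∘_)
import Relation.Binary.Reasoning.Setoid as SetoidReasoning
import Algebra.Properties.CommutativeSemigroup as CommutativeSemigroupProperties

module SprugnoliTheory {c ℓ : Level} (K : Field c ℓ) where
  open Field K hiding (zero)
  open Sprugnoli K
  open SetoidReasoning setoid
  open CommutativeSemigroupProperties +-commutativeSemigroup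
    using () renaming (interchange to +-interchange)
  open CommutativeSemigroupProperties *-commutativeSemigroup
    using () renaming (x∙yz≈y∙xz to *-lcomm; x∙yz≈z∙yx to *-x∙yz≈z∙yx)

  zero-*ˡ : ∀ {a b} → a ≈ 0# → a * b ≈ 0#
  zero-*ˡ a≈0 = trans (*-cong a≈0 refl) (zeroˡ _)

  zero-*ʳ : ∀ {a b} → b ≈ 0# → a * b ≈ 0#
  zero-*ʳ b≈0 = trans (*-cong refl b≈0) (zeroʳ _)

  Σ≤-cong≤ : ∀ n {F G : ℕ → Carrier} → (∀ k → k ≤ n → F k ≈ G k) → Σ≤ n F ≈ Σ≤ n G
  Σ≤-cong≤ zero F≈G = F≈G 0 z≤n
  Σ≤-cong≤ (suc n) F≈G =
    +-cong (Σ≤-cong≤ n (λ k → F≈G k ∘ ℕₚ.m≤n⇒m≤1+n)) (F≈G (suc n) ℕₚ.≤-refl)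

  Σ≤-cong : ∀ n {F G : ℕ → Carrier} → (∀ k → F k ≈ G k) → Σ≤ n F ≈ Σ≤ n G
  Σ≤-cong n F≈G = Σ≤-cong≤ n (λ k _ → F≈G k)

  Σ≤-zero : ∀ n {F : ℕ → Carrier} → (∀ k → k ≤ n → F k ≈ 0#) → Σ≤ n F ≈ 0#
  Σ≤-zero zero F≈0 = F≈0 0 z≤n
  Σ≤-zero (suc n) F≈0 = trans
    (+-cong (Σ≤-zero n (λ k → F≈0 k ∘ ℕₚ.m≤n⇒m≤1+n)) (F≈0 (suc n) ℕₚ.≤-refl))
    (+-identityʳ 0#)

  Σ≤-distrib-+ : ∀ n (F G : ℕ → Carrier) → Σ≤ n (λ k → F k + G k) ≈ Σ≤ n F + Σ≤ n G
  Σ≤-distrib-+ zero F G = refl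
  Σ≤-distrib-+ (suc n) F G = trans (+-cong (Σ≤-distrib-+ n F G) refl) (+-interchange _ _ _ _)

  *-distribˡ-Σ≤ : ∀ n a (F : ℕ → Carrier) → a * Σ≤ n F ≈ Σ≤ n (λ k → a * F k)
  *-distribˡ-Σ≤ zero a F = refl
  *-distribˡ-Σ≤ (suc n) a F = trans (distribˡ a _ _) (+-cong (*-distribˡ-Σ≤ n a F) refl)

  *-distribʳ-Σ≤ : ∀ n a (F : ℕ → Carrier) → Σ≤ n F * a ≈ Σ≤ n (λ k → F k * a)
  *-distribʳ-Σ≤ zero a F = refl
  *-distribʳ-Σ≤ (suc n) a F = trans (distribʳ a _ _) (+-cong (*-distribʳ-Σ≤ n a F) refl)

  Σ≤-*-Σ≤ : ∀ m n (F G : ℕ → Carrier) →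
    Σ≤ m F * Σ≤ n G ≈ Σ≤ m (λ i → Σ≤ n (λ j → F i * G j))
  Σ≤-*-Σ≤ m n F G = trans (*-distribʳ-Σ≤ m _ F) (Σ≤-cong m (λ i → *-distribˡ-Σ≤ n (F i) G))

  Σ≤-comm : ∀ m n (F : ℕ → ℕ → Carrier) →
    Σ≤ m (λ i → Σ≤ n (F i)) ≈ Σ≤ n (λ j → Σ≤ m (λ i → F i j))
  Σ≤-comm zero n F = refl
  Σ≤-comm (suc m) n F = trans (+-cong (Σ≤-comm m n F) refl)
    (sym (Σ≤-distrib-+ n (λ j → Σ≤ m (λ i → F i j)) (F (suc m))))

  Σ≤-unfoldˡ : ∀ n (F : ℕ → Carrier) → Σ≤ (suc n) F ≈ F 0 + Σ≤ n (F ∘ suc)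
  Σ≤-unfoldˡ zero F = refl
  Σ≤-unfoldˡ (suc n) F = trans (+-cong (Σ≤-unfoldˡ n F) refl) (+-assoc _ _ _)

  Σ≤-truncate : ∀ m n {F : ℕ → Carrier} → m ≤ n → (∀ k → m < k → F k ≈ 0#) →
    Σ≤ n F ≈ Σ≤ m F
  Σ≤-truncate m zero z≤n F≈0 = refl
  Σ≤-truncate m (suc n) m≤1+n F≈0 with ℕₚ.m≤n⇒m<n∨m≡n m≤1+n
  ... | inj₂ ≡.refl = refl
  ... | inj₁ (s≤s m≤n) =
    trans (+-cong (Σ≤-truncate m n m≤n F≈0) (F≈0 (suc n) (s≤s m≤n))) (+-identityʳ _)

  Σ≤-single : ∀ {m} n {F : ℕ → Carrier} → m ≤ n → (∀ k → k ≢ m → F k ≈ 0#) →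
    Σ≤ n F ≈ F m
  Σ≤-single {zero} n _ F≈0 = Σ≤-truncate 0 n z≤n (λ k 0<k → F≈0 k (ℕₚ.>⇒≢ 0<k))
  Σ≤-single {suc m} n {F} m<n F≈0 = begin
    Σ≤ n F               ≈⟨ Σ≤-truncate (suc m) n m<n (λ k m<k → F≈0 k (ℕₚ.>⇒≢ m<k)) ⟩
    Σ≤ m F + F (suc m)   ≈⟨ +-cong (Σ≤-zero m (λ k k≤m → F≈0 k (ℕₚ.<⇒≢ (s≤s k≤m)))) refl ⟩
    0# + F (suc m)       ≈⟨ +-identityˡ _ ⟩
    F (suc m)            ∎

  Σ≤-reverse : ∀ n (F : ℕ → Carrier) → Σ≤ n F ≈ Σ≤ n (λ k → F (n ∸ k))
  Σ≤-reverse zero F = refl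
  Σ≤-reverse (suc n) F = begin
    Σ≤ (suc n) F                            ≈⟨ Σ≤-unfoldˡ n F ⟩
    F 0 + Σ≤ n (F ∘ suc)                    ≈⟨ +-cong refl (Σ≤-reverse n (F ∘ suc)) ⟩
    F 0 + Σ≤ n (λ k → F (suc (n ∸ k)))      ≈⟨ +-comm _ _ ⟩
    Σ≤ n (λ k → F (suc (n ∸ k))) + F 0
      ≈⟨ +-cong (Σ≤-cong≤ n (λ k k≤n → reflexive (≡.cong F (≡.sym (ℕₚ.+-∸-assoc 1 k≤n)))))
                (reflexive (≡.cong F (≡.sym (ℕₚ.n∸n≡0 n)))) ⟩
    Σ≤ n (λ k → F (suc n ∸ k)) + F (suc n ∸ suc n) ∎

  -- Summing over the triangle {(i, j) : i + j ≤ n} by antidiagonals or by rows.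
  Σ≤-triangle : ∀ n (F : ℕ → ℕ → Carrier) →
    Σ≤ n (λ k → Σ≤ k (λ i → F i (k ∸ i))) ≈ Σ≤ n (λ i → Σ≤ (n ∸ i) (F i))
  Σ≤-triangle zero F = refl
  Σ≤-triangle (suc n) F = begin
    Σ≤ n (λ k → Σ≤ k (λ i → F i (k ∸ i))) + (Σ≤ n G + G (suc n))
      ≈⟨ +-cong (Σ≤-triangle n F) refl ⟩
    Σ≤ n (λ i → Σ≤ (n ∸ i) (F i)) + (Σ≤ n G + G (suc n))
      ≈⟨ sym (+-assoc _ _ _) ⟩
    (Σ≤ n (λ i → Σ≤ (n ∸ i) (F i)) + Σ≤ n G) + G (suc n)
      ≈⟨ +-cong (sym (Σ≤-distrib-+ n _ _)) (reflexive lastRow) ⟩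
    Σ≤ n (λ i → Σ≤ (n ∸ i) (F i) + G i) + Σ≤ (suc n ∸ suc n) (F (suc n))
      ≈⟨ +-cong (Σ≤-cong≤ n (λ i i≤n → reflexive (≡.trans
                  (≡.cong (λ l → Σ≤ (n ∸ i) (F i) + F i l) (ℕₚ.+-∸-assoc 1 i≤n))
                  (≡.cong (λ l → Σ≤ l (F i)) (≡.sym (ℕₚ.+-∸-assoc 1 i≤n)))))) refl ⟩
    Σ≤ n (λ i → Σ≤ (suc n ∸ i) (F i)) + Σ≤ (suc n ∸ suc n) (F (suc n)) ∎
    where
    G : ℕ → Carrier
    G i = F i (suc n ∸ i)
    lastRow : G (suc n) ≡ Σ≤ (n ∸ n) (F (suc n))
    lastRow = ≡.trans (≡.cong (F (suc n)) (ℕₚ.n∸n≡0 n))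
                      (≡.cong (λ l → Σ≤ l (F (suc n))) (≡.sym (ℕₚ.n∸n≡0 n)))

  Σ≤-triangle-comm : ∀ n (F : ℕ → ℕ → Carrier) → (∀ k l → k < l → F k l ≈ 0#) →
    Σ≤ n (λ k → Σ≤ k (F k)) ≈ Σ≤ n (λ l → Σ≤ n (λ k → F k l))
  Σ≤-triangle-comm n F F≈0 = trans
    (Σ≤-cong≤ n (λ k k≤n → sym (Σ≤-truncate k n k≤n (F≈0 k))))
    (Σ≤-comm n n F)

  ≋-refl : ∀ {f} → f ≋ f
  ≋-refl n = refl

  ≋-sym : ∀ {f h} → f ≋ h → h ≋ f
  ≋-sym f≋h n = sym (f≋h n)

  ≋-trans : ∀ {f h k} → f ≋ h → h ≋ k → f ≋ k
  ≋-trans f≋h h≋k n = trans (f≋h n) (h≋k n)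

  *ₛ-cong : ∀ {f f′ h h′} → f ≋ f′ → h ≋ h′ → f *ₛ h ≋ f′ *ₛ h′
  *ₛ-cong f≋f′ h≋h′ n = Σ≤-cong n (λ k → *-cong (f≋f′ k) (h≋h′ (n ∸ k)))

  *ₛ-congˡ : ∀ f {h h′} → h ≋ h′ → f *ₛ h ≋ f *ₛ h′
  *ₛ-congˡ f = *ₛ-cong (≋-refl {f})

  *ₛ-congʳ : ∀ h {f f′} → f ≋ f′ → f *ₛ h ≋ f′ *ₛ h
  *ₛ-congʳ h f≋f′ = *ₛ-cong f≋f′ (≋-refl {h})

  *ₛ-comm : ∀ f h → f *ₛ h ≋ h *ₛ f
  *ₛ-comm f h n = trans (Σ≤-reverse n _) (Σ≤-cong≤ n (λ k k≤n →
    trans (*-cong refl (reflexive (≡.cong h (ℕₚ.m∸[m∸n]≡n k≤n)))) (*-comm _ _)))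

  *ₛ-assoc : ∀ f g h → (f *ₛ g) *ₛ h ≋ f *ₛ (g *ₛ h)
  *ₛ-assoc f g h n = begin
    Σ≤ n (λ k → Σ≤ k (λ i → f i * g (k ∸ i)) * h (n ∸ k))
      ≈⟨ Σ≤-cong n (λ k → *-distribʳ-Σ≤ k _ _) ⟩
    Σ≤ n (λ k → Σ≤ k (λ i → f i * g (k ∸ i) * h (n ∸ k)))
      ≈⟨ Σ≤-cong≤ n (λ k k≤n → Σ≤-cong≤ k (λ i i≤k →
           trans (*-assoc _ _ _) (*-cong refl (*-cong refl (reflexive (≡.cong h (rest i≤k))))))) ⟩
    Σ≤ n (λ k → Σ≤ k (λ i → F i (k ∸ i)))
      ≈⟨ Σ≤-triangle n F ⟩
    Σ≤ n (λ i → Σ≤ (n ∸ i) (F i))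
      ≈⟨ Σ≤-cong n (λ i → sym (*-distribˡ-Σ≤ (n ∸ i) _ _)) ⟩
    Σ≤ n (λ i → f i * Σ≤ (n ∸ i) (λ j → g j * h (n ∸ i ∸ j))) ∎
    where
    F : ℕ → ℕ → Carrier
    F i j = f i * (g j * h (n ∸ i ∸ j))
    rest : ∀ {i k} → i ≤ k → n ∸ k ≡ n ∸ i ∸ (k ∸ i)
    rest {i} {k} i≤k = ≡.trans (≡.cong (n ∸_) (≡.sym (ℕₚ.m+[n∸m]≡n i≤k)))
                               (≡.sym (ℕₚ.∸-+-assoc n i (k ∸ i)))

  *ₛ-lcomm : ∀ f g h → f *ₛ (g *ₛ h) ≋ g *ₛ (f *ₛ h)
  *ₛ-lcomm f g h = ≋-trans (≋-sym (*ₛ-assoc f g h))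
    (≋-trans (*ₛ-congʳ h (*ₛ-comm f g)) (*ₛ-assoc g f h))

  *ₛ-identityˡ : ∀ f → oneₛ *ₛ f ≋ f
  *ₛ-identityˡ f n = trans
    (Σ≤-single n z≤n λ { zero 0≢0 → ⊥-elim (0≢0 ≡.refl) ; (suc k) _ → zeroˡ _ })
    (*-identityˡ _)

  *ₛ-identityʳ : ∀ f → f *ₛ oneₛ ≋ f
  *ₛ-identityʳ f = ≋-trans (*ₛ-comm f oneₛ) (*ₛ-identityˡ f)

  X*ₛ-head : ∀ h → (X *ₛ h) 0 ≈ 0#
  X*ₛ-head h = zeroˡ _

  X*ₛ-tail : ∀ h n → (X *ₛ h) (suc n) ≈ h n
  X*ₛ-tail h n = trans
    (Σ≤-single (suc n) (s≤s z≤n) λ { zero _ → zeroˡ _ ; (suc zero) 1≢1 → ⊥-elim (1≢1 ≡.refl)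
                                   ; (suc (suc k)) _ → zeroˡ _ })
    (*-identityˡ _)

  X*ₛ-divX : ∀ h → h 0 ≈ 0# → X *ₛ divX h ≋ h
  X*ₛ-divX h h₀≈0 zero = trans (X*ₛ-head (divX h)) (sym h₀≈0)
  X*ₛ-divX h h₀≈0 (suc n) = X*ₛ-tail (divX h) n

  divX-*ₛʳ : ∀ g f → f 0 ≈ 0# → divX (g *ₛ f) ≋ g *ₛ divX f
  divX-*ₛʳ g f f₀≈0 j = begin
    (g *ₛ f) (suc j)                   ≈⟨ *ₛ-comm g f (suc j) ⟩
    (f *ₛ g) (suc j)                   ≈⟨ Σ≤-unfoldˡ j _ ⟩
    f 0 * g (suc j) + (divX f *ₛ g) j  ≈⟨ +-cong (zero-*ˡ f₀≈0) refl ⟩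
    0# + (divX f *ₛ g) j               ≈⟨ +-identityˡ _ ⟩
    (divX f *ₛ g) j                    ≈⟨ *ₛ-comm (divX f) g j ⟩
    (g *ₛ divX f) j                    ∎

  powₛ-X≈idₘ : ∀ l n → powₛ X l n ≈ idₘ n l
  powₛ-X≈idₘ l n with n ℕ.≟ l
  ... | yes ≡.refl = diagonal n
    where
    diagonal : ∀ n → powₛ X n n ≈ 1#
    diagonal zero = refl
    diagonal (suc n) = trans (X*ₛ-tail (powₛ X n) n) (diagonal n)
  ... | no n≢l = offDiagonal l n (n≢l ∘ ≡.sym)
    where
    offDiagonal : ∀ l n → l ≢ n → powₛ X l n ≈ 0#
    offDiagonal zero zero 0≢0 = ⊥-elim (0≢0 ≡.refl)
    offDiagonal zero (suc n) _ = refl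
    offDiagonal (suc l) zero _ = X*ₛ-head (powₛ X l)
    offDiagonal (suc l) (suc n) l≢n =
      trans (X*ₛ-tail (powₛ X l) n) (offDiagonal l n (l≢n ∘ ≡.cong suc))

  Order≥ : ℕ → Series → Set ℓ
  Order≥ p f = ∀ m → m < p → f m ≈ 0#

  Order≥-cong : ∀ {p f h} → f ≋ h → Order≥ p f → Order≥ p h
  Order≥-cong f≋h ord m m<p = trans (sym (f≋h m)) (ord m m<p)

  Order≥-1 : ∀ {f} → f 0 ≈ 0# → Order≥ 1 f
  Order≥-1 f₀≈0 zero _ = f₀≈0
  Order≥-1 f₀≈0 (suc m) (s≤s ())

  Order≥-*ₛ : ∀ {p q f h} → Order≥ p f → Order≥ q h → Order≥ (p ℕ.+ q) (f *ₛ h)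
  Order≥-*ₛ {p} {q} {f} {h} ord-f ord-h m m<p+q = Σ≤-zero m term≈0
    where
    term≈0 : ∀ k → k ≤ m → f k * h (m ∸ k) ≈ 0#
    term≈0 k k≤m with k ℕ.<? p
    ... | yes k<p = zero-*ˡ (ord-f k k<p)
    ... | no k≮p = zero-*ʳ (ord-h (m ∸ k) m∸k<q)
      where
      m∸k<q : m ∸ k < q
      m∸k<q with q ℕ.≤? m ∸ k
      ... | no q≰m∸k = ℕₚ.≰⇒> q≰m∸k
      ... | yes q≤m∸k = ⊥-elim (ℕₚ.<⇒≱ m<p+q (ℕₚ.≤-trans (ℕₚ.+-mono-≤ (ℕₚ.≮⇒≥ k≮p) q≤m∸k)
                                                          (ℕₚ.≤-reflexive (ℕₚ.m+[n∸m]≡n k≤m))))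

  idₘ-diagonal : ∀ n → idₘ n n ≈ 1#
  idₘ-diagonal n with n ℕ.≟ n
  ... | yes _ = refl
  ... | no n≢n = ⊥-elim (n≢n ≡.refl)

  idₘ-offDiagonal : ∀ n k → k ≢ n → idₘ n k ≈ 0#
  idₘ-offDiagonal n k k≢n with n ℕ.≟ k
  ... | yes n≡k = ⊥-elim (k≢n (≡.sym n≡k))
  ... | no _ = refl

  -- act g f₁ f₂ is apply (matrixOf g f₁ f₂) by definition.
  apply : Matrix → Series → Series
  apply M h n = Σ≤ n (λ k → M n k * h k)

  apply-congˡ : ∀ {A B} → A ≋ₘ B → ∀ h → apply A h ≋ apply B h
  apply-congˡ A≋B h n = Σ≤-cong n (λ k → *-cong (A≋B n k) refl)

  apply-congʳ : ∀ A {h h′} → h ≋ h′ → apply A h ≋ apply A h′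
  apply-congʳ A h≋h′ n = Σ≤-cong n (λ k → *-cong refl (h≋h′ k))

  apply-idₘ : ∀ h → apply idₘ h ≋ h
  apply-idₘ h n = trans
    (Σ≤-single n ℕₚ.≤-refl (λ k k≢n → zero-*ˡ (idₘ-offDiagonal n k k≢n)))
    (trans (*-cong (idₘ-diagonal n) refl) (*-identityˡ _))

  apply-extend : ∀ {M} → LowerTriangular M → ∀ h {n m} → n ≤ m →
    apply M h n ≈ Σ≤ m (λ k → M n k * h k)
  apply-extend M-lower h {n} {m} n≤m =
    sym (Σ≤-truncate n m n≤m (λ k n<k → zero-*ˡ (M-lower n k n<k)))

  apply-∙ₘ : ∀ A {B} → LowerTriangular B → ∀ h → apply A (apply B h) ≋ apply (A ∙ₘ B) h
  apply-∙ₘ A {B} B-lower h n = begin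
    Σ≤ n (λ k → A n k * Σ≤ k (λ l → B k l * h l))
      ≈⟨ Σ≤-cong n (λ k → *-distribˡ-Σ≤ k _ _) ⟩
    Σ≤ n (λ k → Σ≤ k (λ l → A n k * (B k l * h l)))
      ≈⟨ Σ≤-triangle-comm n _ (λ k l k<l → zero-*ʳ (zero-*ˡ (B-lower k l k<l))) ⟩
    Σ≤ n (λ l → Σ≤ n (λ k → A n k * (B k l * h l)))
      ≈⟨ Σ≤-cong n (λ l → trans (Σ≤-cong n (λ k → sym (*-assoc _ _ _)))
                                 (sym (*-distribʳ-Σ≤ n _ _))) ⟩
    Σ≤ n (λ l → (A ∙ₘ B) n l * h l) ∎

  apply-leftInverse : ∀ {A B} → (A ∙ₘ B) ≋ₘ idₘ → LowerTriangular B →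
    ∀ h → apply A (apply B h) ≋ h
  apply-leftInverse {A} A∙B≋id B-lower h = ≋-trans (apply-∙ₘ A B-lower h)
    (≋-trans (apply-congˡ A∙B≋id h) (apply-idₘ h))

  apply-scale : ∀ g {M T} → LowerTriangular T → (∀ k → column M k ≋ g *ₛ column T k) →
    ∀ v → apply M v ≋ g *ₛ apply T v
  apply-scale g {M} {T} T-lower M≋gT v j = begin
    Σ≤ j (λ k → M j k * v k)
      ≈⟨ Σ≤-cong j (λ k → trans (*-cong (M≋gT k j) refl) (*-distribʳ-Σ≤ j _ _)) ⟩
    Σ≤ j (λ k → Σ≤ j (λ i → g i * T (j ∸ i) k * v k))
      ≈⟨ Σ≤-comm j j _ ⟩
    Σ≤ j (λ i → Σ≤ j (λ k → g i * T (j ∸ i) k * v k))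
      ≈⟨ Σ≤-cong j (λ i → trans (Σ≤-cong j (λ k → *-assoc _ _ _)) (sym (*-distribˡ-Σ≤ j _ _))) ⟩
    Σ≤ j (λ i → g i * Σ≤ j (λ k → T (j ∸ i) k * v k))
      ≈⟨ Σ≤-cong j (λ i → *-cong refl (sym (apply-extend T-lower v (ℕₚ.m∸n≤m j i)))) ⟩
    Σ≤ j (λ i → g i * apply T v (j ∸ i)) ∎

  apply-*ₛ-expand : ∀ {T} → LowerTriangular T → ∀ e h n →
    apply T (e *ₛ h) n ≈ Σ≤ n (λ i → Σ≤ n (λ j → h j * (e i * T n (i ℕ.+ j))))
  apply-*ₛ-expand {T} T-lower e h n = begin
    Σ≤ n (λ k → T n k * Σ≤ k (λ i → e i * h (k ∸ i)))
      ≈⟨ Σ≤-cong n (λ k → *-distribˡ-Σ≤ k _ _) ⟩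
    Σ≤ n (λ k → Σ≤ k (λ i → T n k * (e i * h (k ∸ i))))
      ≈⟨ Σ≤-cong n (λ k → Σ≤-cong≤ k (λ i i≤k →
           trans (*-cong (reflexive (≡.cong (T n) (≡.sym (ℕₚ.m+[n∸m]≡n i≤k)))) refl)
                 (*-x∙yz≈z∙yx _ _ _))) ⟩
    Σ≤ n (λ k → Σ≤ k (λ i → H i (k ∸ i)))
      ≈⟨ Σ≤-triangle n H ⟩
    Σ≤ n (λ i → Σ≤ (n ∸ i) (H i))
      ≈⟨ Σ≤-cong≤ n (λ i i≤n → sym (Σ≤-truncate (n ∸ i) n (ℕₚ.m∸n≤m n i) (λ j n∸i<j →
           zero-*ʳ (zero-*ʳ (T-lower n (i ℕ.+ j) (beyond i≤n n∸i<j)))))) ⟩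
    Σ≤ n (λ i → Σ≤ n (H i)) ∎
    where
    H : ℕ → ℕ → Carrier
    H i j = h j * (e i * T n (i ℕ.+ j))
    beyond : ∀ {i j} → i ≤ n → n ∸ i < j → n < i ℕ.+ j
    beyond {i} i≤n n∸i<j = ℕₚ.≤-trans (ℕₚ.≤-reflexive (≡.cong suc (≡.sym (ℕₚ.m+[n∸m]≡n i≤n))))
                                      (ℕₚ.+-monoʳ-< i n∸i<j)

  *ₛ-apply-expand : ∀ {T} → LowerTriangular T → ∀ e h n →
    (apply T e *ₛ apply T h) n
      ≈ Σ≤ n (λ i → Σ≤ n (λ j → h j * (e i * (column T i *ₛ column T j) n)))
  *ₛ-apply-expand {T} T-lower e h n = begin
    Σ≤ n (λ a → apply T e a * apply T h (n ∸ a))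
      ≈⟨ Σ≤-cong≤ n (λ a a≤n → trans (*-cong (apply-extend T-lower e a≤n)
                                               (apply-extend T-lower h (ℕₚ.m∸n≤m n a)))
                                      (Σ≤-*-Σ≤ n n _ _)) ⟩
    Σ≤ n (λ a → Σ≤ n (λ i → Σ≤ n (λ j → T a i * e i * (T (n ∸ a) j * h j))))
      ≈⟨ trans (Σ≤-comm n n _) (Σ≤-cong n (λ i → Σ≤-comm n n _)) ⟩
    Σ≤ n (λ i → Σ≤ n (λ j → Σ≤ n (λ a → T a i * e i * (T (n ∸ a) j * h j))))
      ≈⟨ Σ≤-cong n (λ i → Σ≤-cong n (λ j → trans (Σ≤-cong n (λ a → rearrange _ _ _ _))
           (trans (sym (*-distribˡ-Σ≤ n _ _)) (*-cong refl (sym (*-distribˡ-Σ≤ n _ _)))))) ⟩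
    Σ≤ n (λ i → Σ≤ n (λ j → h j * (e i * (column T i *ₛ column T j) n))) ∎
    where
    rearrange : ∀ a b c d → a * b * (c * d) ≈ d * (b * (a * c))
    rearrange a b c d = begin
      a * b * (c * d)   ≈⟨ *-comm _ _ ⟩
      c * d * (a * b)   ≈⟨ *-cong (*-comm c d) (*-comm a b) ⟩
      d * c * (b * a)   ≈⟨ *-assoc _ _ _ ⟩
      d * (c * (b * a)) ≈⟨ *-cong refl (trans (*-lcomm c b a) (*-cong refl (*-comm c a))) ⟩
      d * (b * (a * c)) ∎

  apply-*ₛ : ∀ {T} → LowerTriangular T → ∀ e →
    (∀ i j n → e i * T n (i ℕ.+ j) ≈ e i * (column T i *ₛ column T j) n) →
    ∀ h → apply T (e *ₛ h) ≋ apply T e *ₛ apply T h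
  apply-*ₛ T-lower e multiplicative h n = trans (apply-*ₛ-expand T-lower e h n) (trans
    (Σ≤-cong n (λ i → Σ≤-cong n (λ j → *-cong refl (multiplicative i j n))))
    (sym (*ₛ-apply-expand T-lower e h n)))

  column-dropTop : ∀ M K g f → column M K ≋ g *ₛ f → f 0 ≈ 0# →
    column (dropTop M) K ≋ g *ₛ divX f
  column-dropTop M K g f M≋gf f₀≈0 j = trans (M≋gf (suc j)) (divX-*ₛʳ g f f₀≈0 j)

  double : ℕ → ℕ
  double zero = zero
  double (suc a) = suc (suc (double a))

  double≡2* : ∀ a → double a ≡ 2 ℕ.* a
  double≡2* zero = ≡.refl
  double≡2* (suc a) = ≡.trans (≡.cong (suc ∘ suc) (double≡2* a)) (≡.sym (ℕₚ.*-suc 2 a))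

  even⊎odd : ∀ i → ∃[ a ] (i ≡ double a ⊎ i ≡ suc (double a))
  even⊎odd zero = 0 , inj₁ ≡.refl
  even⊎odd (suc i) with even⊎odd i
  ... | a , inj₁ i≡2a = a , inj₂ (≡.cong suc i≡2a)
  ... | a , inj₂ i≡2a+1 = suc a , inj₁ (≡.cong suc i≡2a+1)

  module SprugnoliColumns (g f₁ f₂ : Series) where
    M : Matrix
    M = matrixOf g f₁ f₂

    column-0 : column M 0 ≋ g
    column-0 = ≋-trans (*ₛ-identityʳ (g *ₛ oneₛ)) (*ₛ-identityʳ g)

    column-1 : column M 1 ≋ g *ₛ f₁
    column-1 = ≋-trans (*ₛ-identityʳ (g *ₛ (f₁ *ₛ oneₛ))) (*ₛ-congˡ g (*ₛ-identityʳ f₁))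

    column-+2 : ∀ k → column M (2 ℕ.+ k) ≋ (X *ₛ f₂) *ₛ column M k
    column-+2 k = ≋-trans
      (*ₛ-congˡ (g *ₛ powₛ f₁ (k ℕ.% 2)) (λ n → reflexive (≡.cong (λ q → powₛ (X *ₛ f₂) q n)
                                                 (m/n≡1+[m∸n]/n {2 ℕ.+ k} {2} (s≤s (s≤s z≤n))))))
      (*ₛ-lcomm (g *ₛ powₛ f₁ (k ℕ.% 2)) (X *ₛ f₂) (powₛ (X *ₛ f₂) (k ℕ./ 2)))

    column-2 : column M 2 ≋ g *ₛ (X *ₛ f₂)
    column-2 = ≋-trans (column-+2 0) (≋-trans (*ₛ-congˡ (X *ₛ f₂) column-0) (*ₛ-comm (X *ₛ f₂) g))

    column-scale : ∀ k → column M k ≋ g *ₛ column (matrixOf oneₛ f₁ f₂) k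
    column-scale k = ≋-trans (*ₛ-assoc g (powₛ f₁ (k ℕ.% 2)) (powₛ (X *ₛ f₂) (k ℕ./ 2)))
      (*ₛ-congˡ g (*ₛ-congʳ (powₛ (X *ₛ f₂) (k ℕ./ 2)) (≋-sym (*ₛ-identityˡ (powₛ f₁ (k ℕ.% 2))))))

    column-order : f₁ 0 ≈ 0# → f₂ 0 ≈ 0# → ∀ k → Order≥ k (column M k)
    column-order _ _ zero = λ _ ()
    column-order f₁₀≈0 _ (suc zero) = Order≥-cong (≋-sym column-1)
      (Order≥-*ₛ {0} {1} {g} (λ _ ()) (Order≥-1 {f₁} f₁₀≈0))
    column-order f₁₀≈0 f₂₀≈0 (suc (suc k)) = Order≥-cong (≋-sym (column-+2 k))
      (Order≥-*ₛ {2} (Order≥-*ₛ {1} {1} {X} (Order≥-1 refl) (Order≥-1 {f₂} f₂₀≈0))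
                     (column-order f₁₀≈0 f₂₀≈0 k))

    matrixOf-lowerTriangular : f₁ 0 ≈ 0# → f₂ 0 ≈ 0# → LowerTriangular M
    matrixOf-lowerTriangular f₁₀≈0 f₂₀≈0 n k = column-order f₁₀≈0 f₂₀≈0 k n

    column-+double : ∀ a j → column M (double a ℕ.+ j) ≋ powₛ (X *ₛ f₂) a *ₛ column M j
    column-+double zero j = ≋-sym (*ₛ-identityˡ (column M j))
    column-+double (suc a) j = ≋-trans (column-+2 (double a ℕ.+ j))
      (≋-trans (*ₛ-congˡ (X *ₛ f₂) (column-+double a j))
               (≋-sym (*ₛ-assoc (X *ₛ f₂) (powₛ (X *ₛ f₂) a) (column M j))))

  sprugnoli-rightInverse : ∀ f₁ f₂ r₁ r₂ → f₁ 0 ≈ 0# → f₂ 0 ≈ 0# → Odd r₂ →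
    ProductIs oneₛ f₁ f₂ oneₛ r₁ r₂ oneₛ X X →
    (matrixOf oneₛ f₁ f₂ ∙ₘ matrixOf oneₛ r₁ r₂) ≋ₘ idₘ
  sprugnoli-rightInverse f₁ f₂ r₁ r₂ f₁₀≈0 f₂₀≈0 r₂-odd (T1≋1 , Tr₁≋X , Txr₂≋x²) n l =
    trans (T-on-column l n) (powₛ-X≈idₘ l n)
    where
    open SprugnoliColumns
    T R : Matrix
    T = matrixOf oneₛ f₁ f₂
    R = matrixOf oneₛ r₁ r₂

    e : Series
    e = X *ₛ r₂

    e-odd : ∀ a → e (suc (double a)) ≈ 0#
    e-odd a = trans (X*ₛ-tail r₂ (double a))
                    (trans (reflexive (≡.cong r₂ (double≡2* a))) (r₂-odd a))

    column-double : ∀ a → column T (double a) ≋ powₛ (X *ₛ f₂) a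
    column-double a = ≋-trans (λ n → reflexive (≡.cong (T n) (≡.sym (ℕₚ.+-identityʳ (double a)))))
      (≋-trans (column-+double oneₛ f₁ f₂ a 0)
      (≋-trans (*ₛ-congˡ (powₛ (X *ₛ f₂) a) (column-0 oneₛ f₁ f₂)) (*ₛ-identityʳ _)))

    column-double-+ : ∀ a j → column T (double a ℕ.+ j) ≋ column T (double a) *ₛ column T j
    column-double-+ a j = ≋-trans (column-+double oneₛ f₁ f₂ a j)
      (*ₛ-congʳ (column T j) (≋-sym (column-double a)))

    T-multiplicative : ∀ i j n → e i * T n (i ℕ.+ j) ≈ e i * (column T i *ₛ column T j) n
    T-multiplicative i j n with even⊎odd i
    ... | a , inj₁ ≡.refl = *-cong refl (column-double-+ a j n)
    ... | a , inj₂ ≡.refl = trans (zero-*ˡ (e-odd a)) (sym (zero-*ˡ (e-odd a)))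

    T-on-e : apply T e ≋ X *ₛ X
    T-on-e = ≋-trans (apply-congʳ T (*ₛ-congʳ r₂ (≋-sym (*ₛ-identityʳ X))))
             (≋-trans (≋-sym Txr₂≋x²) (*ₛ-congˡ X (*ₛ-identityˡ X)))

    T-on-column : ∀ l → apply T (column R l) ≋ powₛ X l
    T-on-column zero = ≋-trans (apply-congʳ T (column-0 oneₛ r₁ r₂)) (≋-sym T1≋1)
    T-on-column (suc zero) = ≋-trans (apply-congʳ T (column-1 oneₛ r₁ r₂))
      (≋-trans (≋-sym Tr₁≋X) (≋-trans (*ₛ-identityˡ X) (≋-sym (*ₛ-identityʳ X))))
    T-on-column (suc (suc l)) = ≋-trans (apply-congʳ T (column-+2 oneₛ r₁ r₂ l))
      (≋-trans (apply-*ₛ (matrixOf-lowerTriangular oneₛ f₁ f₂ f₁₀≈0 f₂₀≈0) e T-multiplicative _)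
      (≋-trans (*ₛ-cong T-on-e (T-on-column l)) (*ₛ-assoc X X (powₛ X l))))

  production-column : ∀ {Minv M T R} g K u →
    LowerTriangular M → LowerTriangular T → LowerTriangular R →
    (∀ k → column M k ≋ g *ₛ column T k) → (Minv ∙ₘ M) ≋ₘ idₘ → (T ∙ₘ R) ≋ₘ idₘ →
    column (dropTop M) K ≋ g *ₛ u → column (production Minv M) K ≋ apply R u
  production-column {Minv} {R = R} g K u M-lower T-lower R-lower M≋gT Minv∙M≋id T∙R≋id M̄≋gu =
    ≋-trans (apply-congʳ Minv (≋-trans M̄≋gu (*ₛ-congˡ g (≋-sym (apply-leftInverse T∙R≋id R-lower u)))))
   (≋-trans (apply-congʳ Minv (≋-sym (apply-scale g T-lower M≋gT (apply R u))))
            (apply-leftInverse Minv∙M≋id M-lower (apply R u)))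

  constantTerm≈0 : ∀ {f} → InF 1 f → f 0 ≈ 0#
  constantTerm≈0 (below-1≈0 , _) = below-1≈0 0 (s≤s z≤n)

mainTheorem10 : ∀ {c ℓ : Level} (K : Field c ℓ) → let open Sprugnoli K in
    CharZero →
    (g f₁ f₂ : Series) → IsSprugnoli g f₁ f₂ →
    (Minv : Matrix) → IsInverseOf Minv (matrixOf g f₁ f₂) →
    (r₁ r₂ : Series) → IsSprugnoli oneₛ r₁ r₂ →
    ProductIs oneₛ f₁ f₂ oneₛ r₁ r₂ oneₛ X X →
    (column (production Minv (matrixOf g f₁ f₂)) 1 ≋ act oneₛ r₁ r₂ (divX f₁))
    × (column (production Minv (matrixOf g f₁ f₂)) 2 ≋ X *ₛ divX (act oneₛ r₁ r₂ f₂))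
mainTheorem10 K _ g f₁ f₂ (_ , f₁∈F₁ , f₂∈F₁ , _) Minv (_ , Minv∙M≋id , _)
              r₁ r₂ (_ , r₁∈F₁ , r₂∈F₁ , r₂-odd) product =
    column-production 1 f₁ (column-1 g f₁ f₂) f₁₀≈0
  , ≋-trans (column-production 2 (X *ₛ f₂) (column-2 g f₁ f₂) (X*ₛ-head f₂))
            (≋-trans (apply-congʳ R (X*ₛ-tail f₂)) (≋-sym (X*ₛ-divX (apply R f₂) (zero-*ʳ f₂₀≈0))))
  where
  open Field K using (_≈_; 0#)
  open Sprugnoli K
  open SprugnoliTheory K
  open SprugnoliColumns using (column-1; column-2; column-scale; matrixOf-lowerTriangular)

  f₁₀≈0 : f₁ 0 ≈ 0#
  f₁₀≈0 = constantTerm≈0 f₁∈F₁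
  f₂₀≈0 : f₂ 0 ≈ 0#
  f₂₀≈0 = constantTerm≈0 f₂∈F₁

  M R : Matrix
  M = matrixOf g f₁ f₂
  R = matrixOf oneₛ r₁ r₂

  column-production : ∀ k f → column M k ≋ g *ₛ f → f 0 ≈ 0# →
    column (production Minv M) k ≋ apply R (divX f)
  column-production k f Mk≋gf f₀≈0 = production-column g k (divX f)
    (matrixOf-lowerTriangular g f₁ f₂ f₁₀≈0 f₂₀≈0)
    (matrixOf-lowerTriangular oneₛ f₁ f₂ f₁₀≈0 f₂₀≈0)
    (matrixOf-lowerTriangular oneₛ r₁ r₂ (constantTerm≈0 r₁∈F₁) (constantTerm≈0 r₂∈F₁))
    (column-scale g f₁ f₂) Minv∙M≋id
    (sprugnoli-rightInverse f₁ f₂ r₁ r₂ f₁₀≈0 f₂₀≈0 r₂-odd product)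
    (column-dropTop M k g f Mk≋gf f₀≈0)
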